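{- Let $\mathtt{vtm}=v_0v_1v_2\cdots$ be the fixed point $\tau^\omega(0)$ of the morphism $\tau$ on $\{0,1,2\}^*$ defined by $\tau(0)=012$, $\tau(1)=02$, $\tau(2)=1$. Then $\mathtt{vtm}$ has an infinite arithmetic progression of $1$'s modulo $4$: there exists an integer $r$ with $0\le r<4$ such that $v_{r+4n}=1$ for all $n\geq 0$.
   Context: The fixed point $\tau^\omega(0)=012021012102012\cdots$ is the limit of $\tau^n(0)$; positions are indexed starting from $0$. -}

module Defs where

open import Data.Nat using (ℕ; zero; suc)
open import Data.Fin using (Fin; zero; suc)
open import Data.List using (List; []; _∷_; concatMap)
open import Data.Maybe using (Maybe; just; nothing)

Letter : Set
Letter = Fin 3

τ : Letter → List Letter
τ zero          = zero ∷ suc zero ∷ suc (suc zero) ∷ []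
τ (suc zero)    = zero ∷ suc (suc zero) ∷ []
τ (suc (suc zero)) = suc zero ∷ []

τ* : List Letter → List Letter
τ* = concatMap τ

τ^ : ℕ → List Letter → List Letter
τ^ zero w    = w
τ^ (suc k) w = τ* (τ^ k w)

at : List Letter → ℕ → Maybe Letter
at []      _       = nothing
at (x ∷ w) zero    = just x
at (x ∷ w) (suc n) = at w n

-- vtm n = v_n, the n-th letter of the fixed point τ^ω(0).
-- τ^k(0) is a prefix of τ^(k+1)(0) and |τ^k(0)| ≥ k+1, so the letter at
-- position n of τ^(n+1)(0) is the n-th letter of the limit.
vtm : ℕ → Maybe Letter
vtm n = at (τ^ (suc n) (zero ∷ [])) n

module Submission where

open import Defs
open import Data.Bool using (Bool; true; false; not)
open import Data.Empty using (⊥)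
open import Data.Fin using (zero; suc)
open import Data.List using (List; []; _∷_; _++_; length; foldl)
open import Data.List.Properties using (length-++)
open import Data.Maybe using (just)
open import Data.Nat using (ℕ; zero; suc; _+_; _*_; _<_; _≤_; z≤n; s≤s)
open import Data.Nat.Properties using (+-mono-≤; *-comm; <-≤-trans; <⇒≤; m≤n⇒m≤1+n)
open import Data.Product using (Σ; ∃; _×_; _,_)
open import Data.Unit using (⊤; tt)
open import Relation.Binary.PropositionalEquality using (_≡_; refl; cong; sym; subst)

-- In vtm the 0s and 2s alternate, starting with 0: deleting the 1s from τ(w)
-- leaves (02)^k.  So for a prefix u of vtm, #0(u) − #2(u) is the parity of the
-- number of 0s and 2s in u, and |τ(u)| = 2|u| + #0(u) − #2(u).  Thus the
-- position modulo 4 together with that parity determines where τ of the next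
-- letter starts modulo 4, and a finite check shows that τ reproduces the
-- following constraints on the letter at each position: 0s and 2s alternate,
-- even positions never carry a 1, and positions ≡ 1 (mod 4) always carry a 1.

pattern L0 = zero
pattern L1 = suc zero
pattern L2 = suc (suc zero)

data Mod4 : Set where
  r0 r1 r2 r3 : Mod4

next : Mod4 → Mod4
next r0 = r1
next r1 = r2
next r2 = r3
next r3 = r0

advance : Mod4 → ℕ → Mod4
advance r zero    = r
advance r (suc i) = advance (next r) i

advance-*4 : ∀ r n → advance r (n * 4) ≡ r
advance-*4 r  zero    = refl
advance-*4 r0 (suc n) = advance-*4 r0 n
advance-*4 r1 (suc n) = advance-*4 r1 n
advance-*4 r2 (suc n) = advance-*4 r2 n
advance-*4 r3 (suc n) = advance-*4 r3 n

-- Position modulo 4, and parity of the number of 0s and 2s read so far (true = odd).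
State : Set
State = Mod4 × Bool

start : State
start = r0 , false

toggle : Bool → Letter → Bool
toggle e L1 = e
toggle e _  = not e

step : State → Letter → State
step (r , e) a = next r , toggle e a

run : State → List Letter → State
run = foldl step

-- For u read up to state (r , e): |τ(u)| ≡ 2r + e (mod 4), and τ(u) has as many 0s as 2s.
image : State → State
image (r0 , false) = r0 , false
image (r0 , true)  = r1 , false
image (r1 , false) = r2 , false
image (r1 , true)  = r3 , false
image (r2 , false) = r0 , false
image (r2 , true)  = r1 , false
image (r3 , false) = r2 , false
image (r3 , true)  = r3 , false

Alternates : Bool → Letter → Set
Alternates false L2 = ⊥
Alternates true  L0 = ⊥
Alternates _     _  = ⊤

ResidueRule : Mod4 → Letter → Set
ResidueRule r1 a  = a ≡ L1
ResidueRule r0 L1 = ⊥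
ResidueRule r2 L1 = ⊥
ResidueRule _  _  = ⊤

Allowed : State → Letter → Set
Allowed (r , e) a = Alternates e a × ResidueRule r a

Admissible : State → List Letter → Set
Admissible s []      = ⊤
Admissible s (a ∷ w) = Allowed s a × Admissible (step s a) w

admissible-++ : ∀ s u {v} → Admissible s u → Admissible (run s u) v → Admissible s (u ++ v)
admissible-++ s []      _            adm-v = adm-v
admissible-++ s (a ∷ u) (ok , adm-u) adm-v = ok , admissible-++ (step s a) u adm-u adm-v

Preserved : State → Letter → Set
Preserved s a = Admissible (image s) (τ a) × run (image s) (τ a) ≡ image (step s a)

allowed-preserved : ∀ s a → Allowed s a → Preserved s a
allowed-preserved (r0 , false) L0 _          = ((tt , tt) , (tt , refl) , (tt , tt) , tt) , refl
allowed-preserved (r0 , false) L1 (_ , ())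
allowed-preserved (r0 , false) L2 (() , _)
allowed-preserved (r0 , true)  L0 (() , _)
allowed-preserved (r0 , true)  L1 (_ , ())
allowed-preserved (r0 , true)  L2 _          = ((tt , refl) , tt) , refl
allowed-preserved (r1 , false) L0 (_ , ())
allowed-preserved (r1 , false) L1 _          = ((tt , tt) , (tt , tt) , tt) , refl
allowed-preserved (r1 , false) L2 (() , _)
allowed-preserved (r1 , true)  L0 (() , _)
allowed-preserved (r1 , true)  L1 _          = ((tt , tt) , (tt , tt) , tt) , refl
allowed-preserved (r1 , true)  L2 (_ , ())
allowed-preserved (r2 , false) L0 _          = ((tt , tt) , (tt , refl) , (tt , tt) , tt) , refl
allowed-preserved (r2 , false) L1 (_ , ())
allowed-preserved (r2 , false) L2 (() , _)
allowed-preserved (r2 , true)  L0 (() , _)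
allowed-preserved (r2 , true)  L1 (_ , ())
allowed-preserved (r2 , true)  L2 _          = ((tt , refl) , tt) , refl
allowed-preserved (r3 , false) L0 _          = ((tt , tt) , (tt , tt) , (tt , tt) , tt) , refl
allowed-preserved (r3 , false) L1 _          = ((tt , tt) , (tt , tt) , tt) , refl
allowed-preserved (r3 , false) L2 (() , _)
allowed-preserved (r3 , true)  L0 (() , _)
allowed-preserved (r3 , true)  L1 _          = ((tt , tt) , (tt , tt) , tt) , refl
allowed-preserved (r3 , true)  L2 _          = ((tt , tt) , tt) , refl

admissible-τ* : ∀ s w → Admissible s w → Admissible (image s) (τ* w)
admissible-τ* s []      _          = tt
admissible-τ* s (a ∷ w) (ok , adm) with allowed-preserved s a ok
... | adm-τa , run-τa = admissible-++ (image s) (τ a) adm-τa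
        (subst (λ s′ → Admissible s′ (τ* w)) (sym run-τa) (admissible-τ* (step s a) w adm))

admissible-τ^ : ∀ k → Admissible start (τ^ k (L0 ∷ []))
admissible-τ^ zero    = (tt , tt) , tt
admissible-τ^ (suc k) = admissible-τ* start (τ^ k (L0 ∷ [])) (admissible-τ^ k)

at-residue-1 : ∀ {r e} w i → Admissible (r , e) w → i < length w → advance r i ≡ r1 → at w i ≡ just L1
at-residue-1 (a ∷ w) zero    ((_ , refl) , _) _           refl = refl
at-residue-1 (a ∷ w) (suc i) (_ , adm)         (s≤s i<|w|) res  = at-residue-1 w i adm i<|w| res

length-τ : ∀ a → 1 ≤ length (τ a)
length-τ L0 = s≤s z≤n
length-τ L1 = s≤s z≤n
length-τ L2 = s≤s z≤n

length-τ* : ∀ w → length w ≤ length (τ* w)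
length-τ* []      = z≤n
length-τ* (a ∷ w) = subst (suc (length w) ≤_) (sym (length-++ (τ a)))
  (+-mono-≤ (length-τ a) (length-τ* w))

τ^-0 : ∀ k → ∃ λ w → τ^ k (L0 ∷ []) ≡ L0 ∷ w
τ^-0 zero    = [] , refl
τ^-0 (suc k) with τ^-0 k
... | w , eq = L1 ∷ L2 ∷ τ* w , cong τ* eq

length-τ*-0∷ : ∀ w → length (L0 ∷ w) < length (τ* (L0 ∷ w))
length-τ*-0∷ w = s≤s (s≤s (m≤n⇒m≤1+n (length-τ* w)))

length-τ^ : ∀ k → k < length (τ^ k (L0 ∷ []))
length-τ^ zero = s≤s z≤n
length-τ^ (suc k) with τ^ k (L0 ∷ []) | τ^-0 k | length-τ^ k
... | _ | w , refl | k<n = <-≤-trans (s≤s k<n) (length-τ*-0∷ w)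

vtm-residue-1 : ∀ m → advance r0 m ≡ r1 → vtm m ≡ just L1
vtm-residue-1 m = at-residue-1 (τ^ (suc m) (L0 ∷ [])) m (admissible-τ^ (suc m))
  (<⇒≤ (length-τ^ (suc m)))

mainTheorem6 : Σ ℕ (λ r → (r < 4) × ((n : ℕ) → vtm (r + 4 * n) ≡ just (suc zero)))
mainTheorem6 = 1 , s≤s (s≤s z≤n) , λ n →
  subst (λ k → vtm (1 + k) ≡ just L1) (*-comm n 4) (vtm-residue-1 (1 + n * 4) (advance-*4 r1 n))
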